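{- There exists an integer $n_0$ such that for every integer $n\ge n_0$ there exists a regular $n$-vertex graph that is $K_3$-saturated. Equivalently, $rsat(n,K_3)$ exists for every $n\ge n_0$.
   Context: All graphs are finite and simple. For a graph $F$, a graph $G$ is $F$-saturated if $G$ contains no copy of $F$, but adding any edge between two non-adjacent vertices of $G$ creates a copy of $F$. For a graph $F$ and integer $n$, $rsat(n,F)$ denotes the smallest number of edges in a regular $n$-vertex $F$-saturated graph; it is said to exist if at least one regular $n$-vertex $F$-saturated graph exists. $K_3$ is the triangle. -}

module Defs where

open import Data.Nat using (ℕ)
open import Data.Bool using (Bool; true; false; _∨_)
open import Data.Fin using (Fin)
open import Data.Fin.Properties using (_≟_)
open import Data.Product using (Σ; ∃; ∃-syntax; _×_; _,_)
open import Data.List using (length; filter)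
open import Data.List using () renaming (allFin to allFinL)
open import Relation.Binary.PropositionalEquality using (_≡_; _≢_)
open import Relation.Nullary using (¬_; Dec; yes; no)
open import Relation.Nullary.Decidable using (⌊_⌋)
open import Data.Bool using (T)
open import Data.Empty using (⊥-elim)

record Graph (n : ℕ) : Set where
  field
    adj   : Fin n → Fin n → Bool
    sym   : ∀ u v → adj u v ≡ adj v u
    irrefl : ∀ u → adj u u ≡ false
open Graph public

degree : ∀ {n} → Graph n → Fin n → ℕ
degree G u = length (filter (λ v → T? (adj G u v)) (allFinL _))
  where
    open import Data.Bool.Properties using (T?)

Regular : ∀ {n} → Graph n → Set
Regular {n} G = ∃[ d ] (∀ u → degree G u ≡ d)

HasTriangle : ∀ {n} → Graph n → Set
HasTriangle {n} G =
  ∃[ x ] ∃[ y ] ∃[ z ] (x ≢ y × y ≢ z × x ≢ z ×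
    adj G x y ≡ true × adj G y z ≡ true × adj G x z ≡ true)

addEdgeAdj : ∀ {n} → Graph n → Fin n → Fin n → Fin n → Fin n → Bool
addEdgeAdj G a b u v =
  adj G u v ∨ ((⌊ u ≟ a ⌋ Data.Bool.∧ ⌊ v ≟ b ⌋) ∨ (⌊ u ≟ b ⌋ Data.Bool.∧ ⌊ v ≟ a ⌋))

addEdge : ∀ {n} → (G : Graph n) → (a b : Fin n) → a ≢ b → Graph n
addEdge G a b a≢b = record
  { adj = addEdgeAdj G a b
  ; sym = symP
  ; irrefl = irr
  }
  where
    open import Data.Bool.Properties using (∨-comm; ∧-comm)
    open import Relation.Binary.PropositionalEquality using (cong₂; trans; refl)
    symP : ∀ u v → addEdgeAdj G a b u v ≡ addEdgeAdj G a b v u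
    symP u v = cong₂ _∨_ (Graph.sym G u v)
      (trans (∨-comm (⌊ u ≟ a ⌋ Data.Bool.∧ ⌊ v ≟ b ⌋) (⌊ u ≟ b ⌋ Data.Bool.∧ ⌊ v ≟ a ⌋))
        (cong₂ _∨_ (∧-comm ⌊ u ≟ b ⌋ ⌊ v ≟ a ⌋) (∧-comm ⌊ u ≟ a ⌋ ⌊ v ≟ b ⌋)))
    irr : ∀ u → addEdgeAdj G a b u u ≡ false
    irr u with adj G u u | Graph.irrefl G u | u ≟ a | u ≟ b
    ... | false | _ | yes refl | yes refl = ⊥-elim (a≢b refl)
    ... | false | _ | yes _ | no _ = refl
    ... | false | _ | no _ | yes _ = refl
    ... | false | _ | no _ | no _ = refl

K3Saturated : ∀ {n} → Graph n → Set
K3Saturated G =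
  ¬ HasTriangle G ×
  (∀ a b → (a≢b : a ≢ b) → adj G a b ≡ false → HasTriangle (addEdge G a b a≢b))

-- Work in the circulant graph on ℤ/N with N = 2c + p whose connection set is
-- S = [p+1, 2p+1] ∪ [c, c+p] ∪ [2c−p−1, 2c−1], a symmetric set.  Any circulant is
-- regular; it is triangle-free iff S is sum-free modulo N, and then adding an edge
-- xy creates a triangle as soon as y − x ∉ S is a sum of two elements of S.  For
-- 4p + 3 ≤ c ≤ 6p + 4 both properties reduce to interval arithmetic, and every
-- n ≥ 52 can be written as 2c + p with such p and c.
module Submission where

open import Data.Bool using (Bool; true; false; if_then_else_; _∨_)
open import Data.Bool.Properties using (T?; ∨-zeroʳ)
open import Data.Empty using (⊥; ⊥-elim)
open import Data.Fin using (Fin; toℕ; fromℕ<) renaming (zero to fzero; suc to fsuc)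
open import Data.Fin.Properties using (toℕ<n; toℕ-fromℕ<) renaming (_≟_ to _≟ᶠ_)
open import Data.List using (_∷_; []; length; filter; tabulate)
open import Data.Nat
open import Data.Nat.Properties
open import Data.Nat.Tactic.RingSolver using (solve)
open import Data.Product using (∃-syntax; _×_; _,_)
open import Data.Sum using (_⊎_; inj₁; inj₂)
open import Function using (_∘_; id)
open import Function.Bundles using (mk⇔)
open import Relation.Binary.PropositionalEquality
open import Relation.Nullary using (¬_; does; yes; no)
open import Relation.Nullary.Decidable using (_×-dec_; _⊎-dec_; dec-true; dec-false; does-⇔)
open import Relation.Unary using (Decidable)
open import Defs hiding (sym)

infixl 6 _⊕_ _⊞_

_⊕_ : ∀ {a b c d} → a ≤ b → c ≤ d → a + c ≤ b + d
_⊕_ = +-mono-≤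

_⊞_ : ∀ {a b c d : ℕ} → a ≡ b → c ≡ d → a + c ≡ b + d
_⊞_ = cong₂ _+_

≡⇒≤ : ∀ {a b} → a ≡ b → a ≤ b
≡⇒≤ = ≤-reflexive

≡⇒≥ : ∀ {a b} → a ≡ b → b ≤ a
≡⇒≥ a≡b = ≤-reflexive (sym a≡b)

-- Linear arithmetic: sum the hypotheses into L ≤ R (or L ≡ R) with _⊕_ (or _⊞_);
-- the goal then follows from an identity, slack k included, checked by the ring solver.
lin≤ : ∀ {L R} → L ≤ R → ∀ x y k → y + L ≡ x + R + k → x ≤ y
lin≤ {L} {R} L≤R x y k eq =
  +-cancelʳ-≤ R x y (≤-trans (m≤m+n (x + R) k) (≤-trans (≤-reflexive (sym eq)) (+-monoʳ-≤ y L≤R)))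

lin⊥ : ∀ {L R} → L ≤ R → ∀ k → L ≡ suc (R + k) → ⊥
lin⊥ {L} {R} L≤R k eq = <-irrefl refl (≤-trans (s≤s (m≤m+n R k)) (≤-trans (≤-reflexive (sym eq)) L≤R))

lin≡ : ∀ {L R} → L ≡ R → ∀ x y → y + L ≡ x + R → x ≡ y
lin≡ {L} L≡R x y eq = sym (+-cancelʳ-≡ L y x (trans eq (cong (x +_) (sym L≡R))))

count : (ℕ → Bool) → ℕ → ℕ → ℕ
count h lo zero      = 0
count h lo (suc len) = (if h lo then 1 else 0) + count h (suc lo) len

count-tabulate : ∀ {m} n (f : Fin n → Fin m) (h : ℕ → Bool) lo → (∀ i → toℕ (f i) ≡ lo + toℕ i) →
                 length (filter (λ v → T? (h (toℕ v))) (tabulate f)) ≡ count h lo n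
count-tabulate zero    f h lo f-shift = refl
count-tabulate (suc n) f h lo f-shift
  rewrite f-shift fzero | +-identityʳ lo with h lo
... | true  = cong suc (count-tabulate n (f ∘ fsuc) h (suc lo) (λ i → trans (f-shift (fsuc i)) (+-suc lo (toℕ i))))
... | false = count-tabulate n (f ∘ fsuc) h (suc lo) (λ i → trans (f-shift (fsuc i)) (+-suc lo (toℕ i)))

count-+ : ∀ h lo a b → count h lo (a + b) ≡ count h lo a + count h (lo + a) b
count-+ h lo zero    b = cong (λ lo′ → count h lo′ b) (sym (+-identityʳ lo))
count-+ h lo (suc a) b = begin
  (if h lo then 1 else 0) + count h (suc lo) (a + b)
    ≡⟨ cong ((if h lo then 1 else 0) +_) (count-+ h (suc lo) a b) ⟩
  (if h lo then 1 else 0) + (count h (suc lo) a + count h (suc lo + a) b)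
    ≡⟨ sym (+-assoc (if h lo then 1 else 0) _ _) ⟩
  count h lo (suc a) + count h (suc lo + a) b
    ≡⟨ cong (λ lo′ → count h lo (suc a) + count h lo′ b) (sym (+-suc lo a)) ⟩
  count h lo (suc a) + count h (lo + suc a) b ∎
  where open ≡-Reasoning

count-cong : ∀ h h′ lo lo′ len → (∀ i → i < len → h (lo + i) ≡ h′ (lo′ + i)) →
             count h lo len ≡ count h′ lo′ len
count-cong h h′ lo lo′ zero      agree = refl
count-cong h h′ lo lo′ (suc len) agree = cong₂ _+_
  (cong (λ b → if b then 1 else 0)
    (trans (cong h (sym (+-identityʳ lo))) (trans (agree 0 z<s) (cong h′ (+-identityʳ lo′)))))
  (count-cong h h′ (suc lo) (suc lo′) len λ i i<len →
    trans (cong h (sym (+-suc lo i))) (trans (agree (suc i) (s<s i<len)) (cong h′ (+-suc lo′ i))))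

addEdge-joins : ∀ {n} (G : Graph n) a b (a≢b : a ≢ b) → adj (addEdge G a b a≢b) a b ≡ true
addEdge-joins G a b _ with a ≟ᶠ a | b ≟ᶠ b
... | yes _   | yes _   = ∨-zeroʳ (adj G a b)
... | no a≢a  | _       = ⊥-elim (a≢a refl)
... | yes _   | no b≢b  = ⊥-elim (b≢b refl)

addEdge-keeps : ∀ {n} (G : Graph n) a b (a≢b : a ≢ b) {u v} →
                adj G u v ≡ true → adj (addEdge G a b a≢b) u v ≡ true
addEdge-keeps G a b a≢b u~v = cong (_∨ _) u~v

module Residues (N : ℕ) where

  -- For a, b, d < N: a + b ≡ d (mod N).
  data ModSum (a b d : ℕ) : Set where
    no-carry : a + b ≡ d     → ModSum a b d
    carry    : a + b ≡ d + N → ModSum a b d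

  SumFree : (ℕ → Set) → Set
  SumFree S = ∀ {a b d} → S a → S b → S d → ModSum a b d → ⊥

  SumComplete : (ℕ → Set) → Set
  SumComplete S = ∀ {e} → e < N → ¬ S e → ∃[ a ] ∃[ b ] (S a × S b × ModSum a b e)

  modSum-comm : ∀ {a b d} → ModSum a b d → ModSum b a d
  modSum-comm {a} {b} (no-carry e) = no-carry (trans (+-comm b a) e)
  modSum-comm {a} {b} (carry e)    = carry (trans (+-comm b a) e)

  modSum-cancelʳ : ∀ {a a′ b d} → ModSum a b d → ModSum a′ b d → a < N → a′ < N → a ≡ a′
  modSum-cancelʳ {a} {a′} {b} (no-carry e) (no-carry e′) _ _ = +-cancelʳ-≡ b a a′ (trans e (sym e′))
  modSum-cancelʳ {a} {a′} {b} (carry e) (carry e′) _ _ = +-cancelʳ-≡ b a a′ (trans e (sym e′))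
  modSum-cancelʳ {a} {a′} {b} {d} (no-carry e) (carry e′) _ a′<N =
    ⊥-elim (lin⊥ (a′<N ⊕ ≡⇒≥ e′ ⊕ ≡⇒≤ e) a (solve (a ∷ a′ ∷ b ∷ d ∷ N ∷ [])))
  modSum-cancelʳ {a} {a′} {b} {d} (carry e) (no-carry e′) a<N _ =
    ⊥-elim (lin⊥ (a<N ⊕ ≡⇒≥ e ⊕ ≡⇒≤ e′) a′ (solve (a ∷ a′ ∷ b ∷ d ∷ N ∷ [])))

  modSum-trans : ∀ {x y z d₁ d₂ d₃} → ModSum d₁ x y → ModSum d₂ y z → ModSum d₃ x z →
                 d₁ < N → d₂ < N → d₃ < N → ModSum d₁ d₂ d₃
  modSum-trans {x} {y} {z} {d₁} {d₂} {d₃} (no-carry e₁) (no-carry e₂) (no-carry e₃) _ _ _ =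
    no-carry (lin≡ (e₁ ⊞ e₂ ⊞ sym e₃) (d₁ + d₂) d₃ (solve (x ∷ y ∷ z ∷ d₁ ∷ d₂ ∷ d₃ ∷ N ∷ [])))
  modSum-trans {x} {y} {z} {d₁} {d₂} {d₃} (no-carry e₁) (no-carry e₂) (carry e₃) _ _ b₃ =
    ⊥-elim (lin⊥ (≡⇒≤ e₁ ⊕ ≡⇒≤ e₂ ⊕ ≡⇒≥ e₃ ⊕ b₃) (d₁ + d₂) (solve (x ∷ y ∷ z ∷ d₁ ∷ d₂ ∷ d₃ ∷ N ∷ [])))
  modSum-trans {x} {y} {z} {d₁} {d₂} {d₃} (no-carry e₁) (carry e₂) (no-carry e₃) _ _ _ =
    carry (lin≡ (e₁ ⊞ e₂ ⊞ sym e₃) (d₁ + d₂) (d₃ + N) (solve (x ∷ y ∷ z ∷ d₁ ∷ d₂ ∷ d₃ ∷ N ∷ [])))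
  modSum-trans {x} {y} {z} {d₁} {d₂} {d₃} (no-carry e₁) (carry e₂) (carry e₃) _ _ _ =
    no-carry (lin≡ (e₁ ⊞ e₂ ⊞ sym e₃) (d₁ + d₂) d₃ (solve (x ∷ y ∷ z ∷ d₁ ∷ d₂ ∷ d₃ ∷ N ∷ [])))
  modSum-trans {x} {y} {z} {d₁} {d₂} {d₃} (carry e₁) (no-carry e₂) (no-carry e₃) _ _ _ =
    carry (lin≡ (e₁ ⊞ e₂ ⊞ sym e₃) (d₁ + d₂) (d₃ + N) (solve (x ∷ y ∷ z ∷ d₁ ∷ d₂ ∷ d₃ ∷ N ∷ [])))
  modSum-trans {x} {y} {z} {d₁} {d₂} {d₃} (carry e₁) (no-carry e₂) (carry e₃) _ _ _ =
    no-carry (lin≡ (e₁ ⊞ e₂ ⊞ sym e₃) (d₁ + d₂) d₃ (solve (x ∷ y ∷ z ∷ d₁ ∷ d₂ ∷ d₃ ∷ N ∷ [])))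
  modSum-trans {x} {y} {z} {d₁} {d₂} {d₃} (carry e₁) (carry e₂) (no-carry e₃) b₁ b₂ _ =
    ⊥-elim (lin⊥ (≡⇒≥ e₁ ⊕ ≡⇒≥ e₂ ⊕ ≡⇒≤ e₃ ⊕ b₁ ⊕ b₂) (suc d₃) (solve (x ∷ y ∷ z ∷ d₁ ∷ d₂ ∷ d₃ ∷ N ∷ [])))
  modSum-trans {x} {y} {z} {d₁} {d₂} {d₃} (carry e₁) (carry e₂) (carry e₃) _ _ _ =
    carry (lin≡ (e₁ ⊞ e₂ ⊞ sym e₃) (d₁ + d₂) (d₃ + N) (solve (x ∷ y ∷ z ∷ d₁ ∷ d₂ ∷ d₃ ∷ N ∷ [])))

  offset : ℕ → ℕ → ℕ
  offset u v with u ≤? v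
  ... | yes _ = v ∸ u
  ... | no  _ = v + N ∸ u

  offset-modSum : ∀ {u v} → u < N → ModSum (offset u v) u v
  offset-modSum {u} {v} u<N with u ≤? v
  ... | yes u≤v = no-carry (m∸n+n≡m u≤v)
  ... | no  _   = carry (m∸n+n≡m (≤-trans (<⇒≤ u<N) (m≤n+m N v)))

  offset-< : ∀ {u v} → u < N → v < N → offset u v < N
  offset-< {u} {v} u<N v<N with u ≤? v
  ... | yes _   = ≤-trans (s≤s (m∸n≤m v u)) v<N
  ... | no  u≰v = wrapped-< (m∸n+n≡m (≤-trans (<⇒≤ u<N) (m≤n+m N v))) (≰⇒> u≰v)
    where
      wrapped-< : ∀ {d} → d + u ≡ v + N → v < u → d < N
      wrapped-< {d} e v<u = lin≤ (≡⇒≤ e ⊕ v<u) (suc d) N 0 (solve (N ∷ u ∷ v ∷ d ∷ []))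

  offset-unique : ∀ {u v d} → u < N → v < N → ModSum d u v → d < N → offset u v ≡ d
  offset-unique u<N v<N d+u≡v d<N = modSum-cancelʳ (offset-modSum u<N) d+u≡v (offset-< u<N v<N) d<N

  offset-self : ∀ {u} → u < N → offset u u ≡ 0
  offset-self u<N = offset-unique u<N u<N (no-carry refl) (≤-trans (s≤s z≤n) u<N)

  offset-+ : ∀ {x y z} → x < N → y < N → z < N → ModSum (offset x y) (offset y z) (offset x z)
  offset-+ x<N y<N z<N = modSum-trans (offset-modSum x<N) (offset-modSum y<N) (offset-modSum x<N)
                                      (offset-< x<N y<N) (offset-< y<N z<N) (offset-< x<N z<N)

  offset-surjective : ∀ {u s} → u < N → s < N → ∃[ w ] (w < N × offset u w ≡ s)
  offset-surjective {u} {s} u<N s<N with suc (u + s) ≤? N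
  ... | yes u+s<N = u + s , u+s<N , offset-unique u<N u+s<N (no-carry (+-comm s u)) s<N
  ... | no  u+s≮N with m≤n⇒∃[o]m+o≡n (≮⇒≥ u+s≮N)
  ... | w , N+w≡u+s =
    w , w<N , offset-unique u<N w<N (carry (trans (+-comm s u) (trans (sym N+w≡u+s) (+-comm N w)))) s<N
    where
      w<N : w < N
      w<N = lin≤ (≡⇒≤ N+w≡u+s ⊕ u<N ⊕ s<N) (suc w) N 1 (solve (u ∷ s ∷ w ∷ N ∷ []))

  offset-split : ∀ {a b s₁ s₂} → a < N → b < N → s₁ < N → s₂ < N → ModSum s₁ s₂ (offset a b) →
                 ∃[ w ] (w < N × offset a w ≡ s₁ × offset w b ≡ s₂)
  offset-split {a} {b} {s₁} {s₂} a<N b<N s₁<N s₂<N s₁+s₂ with offset-surjective a<N s₁<N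
  ... | w , w<N , a→w = w , w<N , a→w ,
        modSum-cancelʳ
          (modSum-comm {s₁} (subst (λ d → ModSum d (offset w b) (offset a b)) a→w (offset-+ a<N w<N b<N)))
          (modSum-comm {s₁} s₁+s₂) (offset-< w<N b<N) s₂<N

  count-offset : ∀ h {u} → u < N → count (h ∘ offset u) 0 N ≡ count h 0 N
  count-offset h {u} u<N with m≤n⇒∃[o]m+o≡n (<⇒≤ u<N)
  ... | m , u+m≡N = begin
      count hᵤ 0 N                  ≡⟨ cong (count hᵤ 0) (sym u+m≡N) ⟩
      count hᵤ 0 (u + m)            ≡⟨ count-+ hᵤ 0 u m ⟩
      count hᵤ 0 u + count hᵤ u m   ≡⟨ cong₂ _+_ (count-cong hᵤ h 0 m u below) (count-cong hᵤ h u 0 m above) ⟩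
      count h m u + count h 0 m     ≡⟨ +-comm (count h m u) (count h 0 m) ⟩
      count h 0 m + count h m u     ≡⟨ sym (count-+ h 0 m u) ⟩
      count h 0 (m + u)             ≡⟨ cong (count h 0) (trans (+-comm m u) u+m≡N) ⟩
      count h 0 N                   ∎
    where
      open ≡-Reasoning
      hᵤ : ℕ → Bool
      hᵤ = h ∘ offset u
      below : ∀ i → i < u → hᵤ i ≡ h (m + i)
      below i i<u = cong h (offset-unique u<N (<-trans i<u u<N) (carry wraps) m+i<N)
        where
          wraps : m + i + u ≡ i + N
          wraps = lin≡ u+m≡N (m + i + u) (i + N) (solve (m ∷ i ∷ u ∷ N ∷ []))
          m+i<N : m + i < N
          m+i<N = lin≤ (≡⇒≤ u+m≡N ⊕ i<u) (suc (m + i)) N 0 (solve (m ∷ i ∷ u ∷ N ∷ []))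
      above : ∀ i → i < m → hᵤ (u + i) ≡ h i
      above i i<m = cong h (offset-unique u<N u+i<N (no-carry (+-comm i u)) (≤-trans (s≤s (m≤n+m i u)) u+i<N))
        where
          u+i<N : u + i < N
          u+i<N = lin≤ (≡⇒≤ u+m≡N ⊕ i<m) (suc (u + i)) N 0 (solve (m ∷ i ∷ u ∷ N ∷ []))

module Circulant (N : ℕ) {S : ℕ → Set} (S? : Decidable S)
                 (0∉S : ¬ S 0) (S-sym : ∀ {s t} → s + t ≡ N → S s → S t) where
  open Residues N

  inS : ℕ → Bool
  inS e = does (S? e)

  circulant : Graph N
  circulant = record
    { adj    = λ x y → inS (offset (toℕ x) (toℕ y))
    ; sym    = λ x y → adj-sym (toℕ<n x) (toℕ<n y)
    ; irrefl = λ x → trans (cong inS (offset-self (toℕ<n x))) (dec-false (S? 0) 0∉S)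
    }
    where
      adj-sym : ∀ {u v} → u < N → v < N → inS (offset u v) ≡ inS (offset v u)
      adj-sym {u} {v} u<N v<N with subst (ModSum (offset u v) (offset v u)) (offset-self u<N) (offset-+ u<N v<N u<N)
      ... | no-carry sum≡0 = cong inS (trans (m+n≡0⇒m≡0 (offset u v) sum≡0) (sym (m+n≡0⇒n≡0 (offset u v) sum≡0)))
      ... | carry sum≡N =
        does-⇔ (mk⇔ (S-sym sum≡N) (S-sym (trans (+-comm (offset v u) (offset u v)) sum≡N))) (S? _) (S? _)

  adjacent⇒∈ : ∀ {x y} → adj circulant x y ≡ true → S (offset (toℕ x) (toℕ y))
  adjacent⇒∈ {x} {y} x~y with S? (offset (toℕ x) (toℕ y))
  ... | yes s = s

  nonadjacent⇒∉ : ∀ {x y} → adj circulant x y ≡ false → ¬ S (offset (toℕ x) (toℕ y))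
  nonadjacent⇒∉ {x} {y} x≁y with S? (offset (toℕ x) (toℕ y))
  ... | no s∉S = s∉S

  ∈⇒adjacent : ∀ {x y} → S (offset (toℕ x) (toℕ y)) → adj circulant x y ≡ true
  ∈⇒adjacent = dec-true (S? _)

  circulant-regular : Regular circulant
  circulant-regular = count inS 0 N , λ u →
    trans (count-tabulate N id (inS ∘ offset (toℕ u)) 0 (λ _ → refl)) (count-offset inS (toℕ<n u))

  circulant-triangleFree : SumFree S → ¬ HasTriangle circulant
  circulant-triangleFree sumFree (x , y , z , _ , _ , _ , x~y , y~z , x~z) =
    sumFree (adjacent⇒∈ {x} {y} x~y) (adjacent⇒∈ {y} {z} y~z) (adjacent⇒∈ {x} {z} x~z)
            (offset-+ (toℕ<n x) (toℕ<n y) (toℕ<n z))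

  circulant-saturating : (∀ {s} → S s → s < N) → SumComplete S →
                         ∀ a b (a≢b : a ≢ b) → adj circulant a b ≡ false → HasTriangle (addEdge circulant a b a≢b)
  circulant-saturating S<N complete a b a≢b a≁b
    with complete (offset-< (toℕ<n a) (toℕ<n b)) (nonadjacent⇒∉ {a} {b} a≁b)
  ... | s₁ , s₂ , S₁ , S₂ , s₁+s₂ with offset-split (toℕ<n a) (toℕ<n b) (S<N S₁) (S<N S₂) s₁+s₂
  ... | w , w<N , a→w , w→b with fromℕ< w<N | toℕ-fromℕ< w<N
  ... | w′ | refl =
    a , b , w′ , a≢b , b≢w′ , a≢w′ ,
    addEdge-joins circulant a b a≢b ,
    addEdge-keeps circulant a b a≢b {b} {w′}
      (trans (Graph.sym circulant b w′) (∈⇒adjacent {w′} {b} (subst S (sym w→b) S₂))) ,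
    addEdge-keeps circulant a b a≢b {a} {w′} (∈⇒adjacent {a} {w′} (subst S (sym a→w) S₁))
    where
      a≢w′ : a ≢ w′
      a≢w′ refl = 0∉S (subst S (trans (sym a→w) (offset-self (toℕ<n a))) S₁)
      b≢w′ : b ≢ w′
      b≢w′ refl = 0∉S (subst S (trans (sym w→b) (offset-self (toℕ<n b))) S₂)

module ThreeIntervals (p c : ℕ) (c-lower : 3 + 4 * p ≤ c) (c-upper : c ≤ 4 + 6 * p) where
  open Residues (c + c + p)

  -- High e says e ∈ [2c − p − 1, 2c − 1], avoiding truncated subtraction.
  Low Mid High S : ℕ → Set
  Low  e = 1 + p ≤ e × e ≤ 1 + 2 * p
  Mid  e = c ≤ e × e ≤ c + p
  High e = c + c ≤ e + (1 + p) × e < c + c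
  S    e = Low e ⊎ Mid e ⊎ High e

  S? : Decidable S
  S? e = ((1 + p ≤? e) ×-dec (e ≤? 1 + 2 * p))
    ⊎-dec ((c ≤? e) ×-dec (e ≤? c + p))
    ⊎-dec ((c + c ≤? e + (1 + p)) ×-dec (suc e ≤? c + c))

  S⇒<2c : ∀ {e} → S e → e < c + c
  S⇒<2c {e} (inj₁ (_ , e≤)) = lin≤ (e≤ ⊕ c-lower) (suc e) (c + c) (c + 2 * p + 1) (solve (e ∷ p ∷ c ∷ []))
  S⇒<2c {e} (inj₂ (inj₁ (_ , e≤))) = lin≤ (e≤ ⊕ c-lower) (suc e) (c + c) (3 * p + 2) (solve (e ∷ p ∷ c ∷ []))
  S⇒<2c (inj₂ (inj₂ (_ , e<))) = e<

  S⇒<N : ∀ {e} → S e → e < c + c + p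
  S⇒<N s = ≤-trans (S⇒<2c s) (m≤m+n (c + c) p)

  0∉S : ¬ S 0
  0∉S (inj₁ (() , _))
  0∉S (inj₂ (inj₁ (c≤0 , _))) = lin⊥ (c≤0 ⊕ c-lower) (2 + 4 * p) (solve (p ∷ c ∷ []))
  0∉S (inj₂ (inj₂ (2c≤ , _))) = lin⊥ (2c≤ ⊕ c-lower) (c + 3 * p + 1) (solve (p ∷ c ∷ []))

  S-sym : ∀ {e e′} → e + e′ ≡ c + c + p → S e → S e′
  S-sym {e} {e′} eq (inj₁ (a , b)) = inj₂ (inj₂
    ( lin≤ (≡⇒≥ eq ⊕ b) (c + c) (e′ + (1 + p)) 0 (solve (e ∷ e′ ∷ p ∷ c ∷ []))
    , lin≤ (≡⇒≤ eq ⊕ a) (suc e′) (c + c) 0 (solve (e ∷ e′ ∷ p ∷ c ∷ []))))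
  S-sym {e} {e′} eq (inj₂ (inj₁ (a , b))) = inj₂ (inj₁
    ( lin≤ (≡⇒≥ eq ⊕ b) c e′ 0 (solve (e ∷ e′ ∷ p ∷ c ∷ []))
    , lin≤ (≡⇒≤ eq ⊕ a) e′ (c + p) 0 (solve (e ∷ e′ ∷ p ∷ c ∷ []))))
  S-sym {e} {e′} eq (inj₂ (inj₂ (a , b))) = inj₁
    ( lin≤ (≡⇒≥ eq ⊕ b) (1 + p) e′ 0 (solve (e ∷ e′ ∷ p ∷ c ∷ []))
    , lin≤ (≡⇒≤ eq ⊕ a) e′ (1 + 2 * p) 0 (solve (e ∷ e′ ∷ p ∷ c ∷ [])))

  S-complement : ∀ {s} → S s → ∃[ s′ ] (s + s′ ≡ c + c + p × S s′)
  S-complement s∈S with m≤n⇒∃[o]m+o≡n (<⇒≤ (S⇒<N s∈S))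
  ... | s′ , s+s′≡N = s′ , s+s′≡N , S-sym s+s′≡N s∈S

  ≥2c⇒∉S : ∀ {d} → c + c ≤ d → ¬ S d
  ≥2c⇒∉S 2c≤d d∈S = <⇒≱ (S⇒<2c d∈S) 2c≤d

  Low-sumFree : ∀ {a b d} → Low a → S b → S d → a + b ≡ d → ⊥
  Low-sumFree {a} {b} {d} (a₁ , b₁) (inj₁ (a₂ , b₂)) (inj₁ (a₃ , b₃)) eq =
    lin⊥ (a₁ ⊕ a₂ ⊕ b₃ ⊕ ≡⇒≤ eq) 0 (solve (a ∷ b ∷ d ∷ p ∷ []))
  Low-sumFree {a} {b} {d} (a₁ , b₁) (inj₁ (a₂ , b₂)) (inj₂ (inj₁ (a₃ , b₃))) eq =
    lin⊥ (b₁ ⊕ b₂ ⊕ a₃ ⊕ c-lower ⊕ ≡⇒≥ eq) 0 (solve (a ∷ b ∷ d ∷ p ∷ c ∷ []))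
  Low-sumFree {a} {b} {d} (a₁ , b₁) (inj₁ (a₂ , b₂)) (inj₂ (inj₂ (a₃ , b₃))) eq =
    lin⊥ (c-lower ⊕ c-lower ⊕ a₃ ⊕ b₁ ⊕ b₂ ⊕ ≡⇒≥ eq) (2 + 3 * p) (solve (a ∷ b ∷ d ∷ p ∷ c ∷ []))
  Low-sumFree {a} {b} {d} (a₁ , b₁) (inj₂ (inj₁ (a₂ , b₂))) (inj₁ (a₃ , b₃)) eq =
    lin⊥ (a₂ ⊕ b₃ ⊕ ≡⇒≤ eq ⊕ c-lower) (a + 2 * p + 1) (solve (a ∷ b ∷ d ∷ p ∷ c ∷ []))
  Low-sumFree {a} {b} {d} (a₁ , b₁) (inj₂ (inj₁ (a₂ , b₂))) (inj₂ (inj₁ (a₃ , b₃))) eq =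
    lin⊥ (a₁ ⊕ a₂ ⊕ b₃ ⊕ ≡⇒≤ eq) 0 (solve (a ∷ b ∷ d ∷ p ∷ c ∷ []))
  Low-sumFree {a} {b} {d} (a₁ , b₁) (inj₂ (inj₁ (a₂ , b₂))) (inj₂ (inj₂ (a₃ , b₃))) eq =
    lin⊥ (a₃ ⊕ b₁ ⊕ b₂ ⊕ ≡⇒≥ eq ⊕ c-lower) 0 (solve (a ∷ b ∷ d ∷ p ∷ c ∷ []))
  Low-sumFree {a} {b} {d} (a₁ , b₁) (inj₂ (inj₂ (a₂ , b₂))) d∈S eq =
    ≥2c⇒∉S (lin≤ (a₁ ⊕ a₂ ⊕ ≡⇒≤ eq) (c + c) d 0 (solve (a ∷ b ∷ d ∷ p ∷ c ∷ []))) d∈S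

  Mid-sumFree : ∀ {a b d} → Mid a → Mid b ⊎ High b → S d → a + b ≡ d → ⊥
  Mid-sumFree (a₁ , _) (inj₁ (a₂ , _)) d∈S eq = ≥2c⇒∉S (≤-trans (a₁ ⊕ a₂) (≡⇒≤ eq)) d∈S
  Mid-sumFree {a} {b} {d} (a₁ , _) (inj₂ (a₂ , _)) d∈S eq =
    ≥2c⇒∉S (lin≤ (a₁ ⊕ a₂ ⊕ c-lower ⊕ ≡⇒≤ eq) (c + c) d (2 + 3 * p) (solve (a ∷ b ∷ d ∷ p ∷ c ∷ []))) d∈S

  High-sumFree : ∀ {a b d} → High a → High b → S d → a + b ≡ d → ⊥
  High-sumFree {a} {b} {d} (a₁ , _) (a₂ , _) d∈S eq =
    ≥2c⇒∉S (lin≤ (a₁ ⊕ a₂ ⊕ c-lower ⊕ ≡⇒≤ eq) (c + c) d (c + 2 * p + 1) (solve (a ∷ b ∷ d ∷ p ∷ c ∷ []))) d∈S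

  S-sumFreeℕ : ∀ {a b d} → S a → S b → S d → a + b ≡ d → ⊥
  S-sumFreeℕ (inj₁ a∈L) b∈S d∈S eq = Low-sumFree a∈L b∈S d∈S eq
  S-sumFreeℕ {a} {b} (inj₂ a∈MH) (inj₁ b∈L) d∈S eq = Low-sumFree b∈L (inj₂ a∈MH) d∈S (trans (+-comm b a) eq)
  S-sumFreeℕ (inj₂ (inj₁ a∈M)) (inj₂ b∈MH) d∈S eq = Mid-sumFree a∈M b∈MH d∈S eq
  S-sumFreeℕ {a} {b} (inj₂ (inj₂ a∈H)) (inj₂ (inj₁ b∈M)) d∈S eq =
    Mid-sumFree b∈M (inj₂ a∈H) d∈S (trans (+-comm b a) eq)
  S-sumFreeℕ (inj₂ (inj₂ a∈H)) (inj₂ (inj₂ b∈H)) d∈S eq = High-sumFree a∈H b∈H d∈S eq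

  -- A carry is undone by passing to the complements N − a, N − b, N − d, which lie in S.
  S-sumFree : SumFree S
  S-sumFree a∈S b∈S d∈S (no-carry eq) = S-sumFreeℕ a∈S b∈S d∈S eq
  S-sumFree {a} {b} {d} a∈S b∈S d∈S (carry eq)
    with S-complement a∈S | S-complement b∈S | S-complement d∈S
  ... | a′ , fa , a′∈S | b′ , fb , b′∈S | d′ , fd , d′∈S = S-sumFreeℕ a′∈S b′∈S d′∈S
    (lin≡ (fa ⊞ fb ⊞ sym (fd ⊞ eq)) (a′ + b′) d′ (solve (a ∷ b ∷ d ∷ a′ ∷ b′ ∷ d′ ∷ p ∷ c ∷ [])))

  p+1≤2p+1 : 1 + p ≤ 1 + 2 * p
  p+1≤2p+1 = s≤s (m≤m+n p (p + 0))

  -- e ≤ p or c − p − 1 ≤ e: (c + p) + (c + e) ≡ e + N; 2p + 1 < e ≤ 4p + 2: a sum of two elements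
  -- of Low; otherwise c + (e + c + p) ≡ e + N, the one place where c ≤ 6p + 4 is needed.
  S-complete-below : ∀ {e} → e < c → ¬ S e → ∃[ a ] ∃[ b ] (S a × S b × ModSum a b e)
  S-complete-below {e} e<c e∉S with e ≤? p
  ... | yes e≤p =
    c + p , c + e , inj₂ (inj₁ (m≤m+n c p , ≤-refl)) , inj₂ (inj₁ (m≤m+n c e , +-monoʳ-≤ c e≤p)) ,
    carry (solve (e ∷ p ∷ c ∷ []))
  ... | no e≰p with e ≤? 1 + 2 * p
  ... | yes e≤2p+1 = ⊥-elim (e∉S (inj₁ (≰⇒> e≰p , e≤2p+1)))
  ... | no e≰2p+1 with e ≤? 2 + 3 * p
  ... | yes e≤3p+2 with m≤n⇒∃[o]m+o≡n (≰⇒> e≰p)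
  ... | t , refl =
    1 + p , t , inj₁ (≤-refl , p+1≤2p+1) ,
    inj₁ ( lin≤ (≰⇒> e≰2p+1) (1 + p) t 0 (solve (p ∷ t ∷ []))
         , lin≤ e≤3p+2 t (1 + 2 * p) 0 (solve (p ∷ t ∷ []))) ,
    no-carry refl
  S-complete-below {e} e<c e∉S | no e≰p | no e≰2p+1 | no e≰3p+2 with e ≤? 2 + 4 * p
  ... | yes e≤4p+2 with m≤n⇒∃[o]m+o≡n (<⇒≤ (≰⇒> e≰2p+1))
  ... | t , refl =
    1 + 2 * p , t , inj₁ (p+1≤2p+1 , ≤-refl) ,
    inj₁ ( lin≤ (≰⇒> e≰3p+2) (1 + p) t 1 (solve (p ∷ t ∷ []))
         , lin≤ e≤4p+2 t (1 + 2 * p) 0 (solve (p ∷ t ∷ []))) ,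
    no-carry refl
  S-complete-below {e} e<c e∉S | no e≰p | no e≰2p+1 | no e≰3p+2 | no e≰4p+2 with c ≤? e + (1 + p)
  ... | yes c≤e+p+1 =
    c + p , c + e , inj₂ (inj₁ (m≤m+n c p , ≤-refl)) ,
    inj₂ (inj₂ ( lin≤ c≤e+p+1 (c + c) (c + e + (1 + p)) 0 (solve (e ∷ p ∷ c ∷ []))
               , +-monoʳ-< c e<c)) ,
    carry (solve (e ∷ p ∷ c ∷ []))
  ... | no c≰e+p+1 =
    c , e + c + p , inj₂ (inj₁ (≤-refl , m≤m+n c p)) ,
    inj₂ (inj₂ ( lin≤ (c-upper ⊕ ≰⇒> e≰4p+2) (c + c) (e + c + p + (1 + p)) 0 (solve (e ∷ p ∷ c ∷ []))
               , lin≤ (≰⇒> c≰e+p+1) (suc (e + c + p)) (c + c) 1 (solve (e ∷ p ∷ c ∷ [])))) ,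
    carry (solve (e ∷ p ∷ c ∷ []))

  -- Above c + p, pass to the complement N − e < c.
  S-complete : SumComplete S
  S-complete {e} e<N e∉S with e <? c
  ... | yes e<c = S-complete-below e<c e∉S
  ... | no e≮c with e ≤? c + p
  ... | yes e≤c+p = ⊥-elim (e∉S (inj₂ (inj₁ (≮⇒≥ e≮c , e≤c+p))))
  ... | no e≰c+p with m≤n⇒∃[o]m+o≡n (<⇒≤ e<N)
  ... | e′ , e+e′≡N
    with S-complete-below (lin≤ (≡⇒≤ e+e′≡N ⊕ ≰⇒> e≰c+p) (suc e′) c 0 (solve (e ∷ e′ ∷ p ∷ c ∷ [])))
                          (λ e′∈S → e∉S (S-sym (trans (+-comm e′ e) e+e′≡N) e′∈S))
  ... | a′ , b′ , a′∈S , b′∈S , a′+b′ with S-complement a′∈S | S-complement b′∈S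
  ... | a , fa , a∈S | b , fb , b∈S = a , b , a∈S , b∈S , complement-sum a′+b′
    where
      complement-sum : ModSum a′ b′ e′ → ModSum a b e
      complement-sum (no-carry k) = carry
        (lin≡ (fa ⊞ fb ⊞ sym (e+e′≡N ⊞ k)) (a + b) (e + (c + c + p)) (solve (e ∷ e′ ∷ a ∷ b ∷ a′ ∷ b′ ∷ p ∷ c ∷ [])))
      complement-sum (carry k) = no-carry
        (lin≡ (fa ⊞ fb ⊞ sym (e+e′≡N ⊞ k)) (a + b) e (solve (e ∷ e′ ∷ a ∷ b ∷ a′ ∷ b′ ∷ p ∷ c ∷ [])))

Admissible : ℕ → Set
Admissible n = ∃[ p ] ∃[ c ] (3 + 4 * p ≤ c × c ≤ 4 + 6 * p × c + c + p ≡ n)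

admissible-52 : Admissible 52
admissible-52 = 4 , 24 , m≤m+n 19 5 , m≤m+n 24 4 , refl

-- Step to (p + 1, c) if that is admissible, else to (p − 1, c + 1); the latter needs p ≥ 5, forced by n ≥ 52.
admissible-suc : ∀ {n} → 52 ≤ n → Admissible n → Admissible (suc n)
admissible-suc 52≤n (p , c , lower , upper , refl) with 3 + 4 * suc p ≤? c
... | yes lower′ = suc p , c , lower′ , lin≤ upper c (4 + 6 * suc p) 6 (solve (p ∷ c ∷ [])) , +-suc (c + c) p
... | no c≱4p+7 with 5 ≤? p
... | no p≱5 = ⊥-elim (<⇒≱ n<52 52≤n)
  where
    9p≤36 : 9 * p ≤ 36
    9p≤36 = *-monoʳ-≤ 9 (≤-pred (≰⇒> p≱5))
    n<52 : c + c + p < 52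
    n<52 = lin≤ (≰⇒> c≱4p+7 ⊕ ≰⇒> c≱4p+7 ⊕ 9p≤36) (suc (c + c + p)) 52 3 (solve (p ∷ c ∷ []))
... | yes p≥5 with m≤n⇒∃[o]m+o≡n p≥5
... | t , refl =
  4 + t , suc c ,
  lin≤ lower (3 + 4 * (4 + t)) (suc c) 5 (solve (t ∷ c ∷ [])) ,
  lin≤ (≰⇒> c≱4p+7) (suc c) (4 + 6 * (4 + t)) (1 + 2 * t) (solve (t ∷ c ∷ [])) ,
  solve (t ∷ c ∷ [])

admissible : ∀ {n} → 52 ≤ n → Admissible n
admissible {suc n} 52≤1+n with 52 ≤? n
... | yes 52≤n = admissible-suc 52≤n (admissible 52≤n)
... | no  52≰n = subst Admissible (≤-antisym 52≤1+n (≰⇒> 52≰n)) admissible-52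

admissible⇒regular-K3Saturated : ∀ {n} → Admissible n → ∃[ G ] (Regular {n} G × K3Saturated G)
admissible⇒regular-K3Saturated (p , c , lower , upper , refl) =
  circulant , circulant-regular , circulant-triangleFree S-sumFree , circulant-saturating S⇒<N S-complete
  where
    open ThreeIntervals p c lower upper
    open Circulant (c + c + p) S? 0∉S S-sym

theorem1p1 : ∃[ n₀ ] (∀ n → n ≥ n₀ → ∃[ G ] (Regular {n} G × K3Saturated G))
theorem1p1 = 52 , λ _ n≥52 → admissible⇒regular-K3Saturated (admissible n≥52)
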